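{- As $\mathbb{L}$-species, $\mathcal{S} = E + E*\mathcal{S}^{\bullet}$.
   Context: An $\mathbb{L}$-species assigns to each finite totally ordered set $\ell$ a finite set $F[\ell]$, functorially in order-preserving bijections; isomorphic $\mathbb{L}$-species are written as equal. $\mathcal{S}$ is the species of permutations ($\mathcal{S}[\ell]$ = bijections $\ell\to\ell$); $E$ is the species of sets (exactly one structure on each $\ell$); $X$ is the singleton species (one structure on one-element sets, none otherwise). Sum: $(F+G)[\ell]=F[\ell]\sqcup G[\ell]$. Pointing: $F^{\bullet}[\ell]=F[\ell]\times\ell$. Ordinal product: $(F\odot G)[\ell]=\bigsqcup_{\ell=\ell_1\oplus\ell_2}F[\ell_1]\times G[\ell_2]$, the union over splittings of $\ell$ into an initial segment $\ell_1$ and the complementary terminal segment $\ell_2$. Convolution: $F*G=F\odot X\odot G$. -}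

module Defs where

-- L-species, presented on the skeleton of finite totally ordered sets:
-- every finite total order ℓ of size n is uniquely (order-)isomorphic to
-- Fin n with its natural order, and the only order-preserving bijection
-- between two such sets is this unique one.  An L-species is therefore
-- given by its values F[n] := F[Fin n], and a natural isomorphism of
-- L-species is a family of bijections F[n] ≅ G[n].
-- Structure sets are setoids so that bijections between sets of functions
-- (permutations) can be stated without function extensionality.

open import Level using (0ℓ)
open import Data.Nat using (ℕ; _∸_)
open import Data.Fin using (Fin; toℕ)
open import Data.Unit using (⊤; tt)
open import Data.Product using (Σ; _×_; _,_)
open import Data.Fin.Permutation using (Permutation′; _⟨$⟩ʳ_)
open import Relation.Binary.Bundles using (Setoid)
open import Relation.Binary.Structures using (IsEquivalence)
open import Relation.Binary.PropositionalEquality as ≡ using (_≡_; refl)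
open import Data.Sum.Relation.Binary.Pointwise using (_⊎ₛ_)
open import Data.Product.Relation.Binary.Pointwise.NonDependent using (_×ₛ_)
open import Function.Bundles using (Inverse)

LSpecies : Set₁
LSpecies = ℕ → Setoid 0ℓ 0ℓ

infix 3 _≅_
_≅_ : LSpecies → LSpecies → Set
F ≅ G = ∀ n → Inverse (F n) (G n)

E : LSpecies
E n = ≡.setoid ⊤

X : LSpecies
X n = ≡.setoid (n ≡ 1)

S : LSpecies
S n = record
  { Carrier = Permutation′ n
  ; _≈_ = λ σ τ → ∀ i → σ ⟨$⟩ʳ i ≡ τ ⟨$⟩ʳ i
  ; isEquivalence = record
    { refl = λ i → refl
    ; sym = λ p i → ≡.sym (p i)
    ; trans = λ p q i → ≡.trans (p i) (q i)
    }
  }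

infixl 6 _+ₛ_
_+ₛ_ : LSpecies → LSpecies → LSpecies
(F +ₛ G) n = F n ⊎ₛ G n

_• : LSpecies → LSpecies
(F •) n = F n ×ₛ ≡.setoid (Fin n)

-- ordinal product: a splitting ℓ = ℓ₁ ⊕ ℓ₂ of Fin n into an initial
-- segment and the complementary terminal segment is determined by the
-- size k ∈ {0,…,n} of ℓ₁; then ℓ₁ ≅ Fin k and ℓ₂ ≅ Fin (n ∸ k).
module _ (F G : LSpecies) (n : ℕ) where
  private
    module F k = Setoid (F k)
    module G k = Setoid (G k)

  ⊙Carrier : Set
  ⊙Carrier = Σ (Fin (Data.Nat.suc n)) λ k →
               F.Carrier (toℕ k) × G.Carrier (n ∸ toℕ k)

  data ⊙Eq : ⊙Carrier → ⊙Carrier → Set where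
    ⊙eq : ∀ {k a a′ b b′} → F._≈_ (toℕ k) a a′ → G._≈_ (n ∸ toℕ k) b b′ →
          ⊙Eq (k , a , b) (k , a′ , b′)

  ⊙Eq-isEquivalence : IsEquivalence ⊙Eq
  ⊙Eq-isEquivalence = record
    { refl = λ { {k , a , b} → ⊙eq (F.refl (toℕ k)) (G.refl (n ∸ toℕ k)) }
    ; sym = λ { {k , _} (⊙eq p q) → ⊙eq (F.sym (toℕ k) p) (G.sym (n ∸ toℕ k) q) }
    ; trans = λ { {k , _} (⊙eq p q) (⊙eq p′ q′) →
                  ⊙eq (F.trans (toℕ k) p p′) (G.trans (n ∸ toℕ k) q q′) }
    }

infixr 7 _⊙_
_⊙_ : LSpecies → LSpecies → LSpecies
(F ⊙ G) n = record
  { Carrier = ⊙Carrier F G n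
  ; _≈_ = ⊙Eq F G n
  ; isEquivalence = ⊙Eq-isEquivalence F G n
  }

infixr 7 _*_
_*_ : LSpecies → LSpecies → LSpecies
F * G = F ⊙ (X ⊙ G)

-- Both sides obey the same recursion in the number of points.  A permutation
-- of 1 + n points is determined by the image of the first point together with
-- the permutation that 'remove' induces on the other n points; according as
-- that image is the first point or not, S[1+n] ≅ S[n] + S•[n].  An
-- (E * G)-structure on 1 + n points either has an empty initial segment, so
-- that its singleton is the first point and G lives on the remaining n points,
-- or dropping the first point of its initial segment leaves an
-- (E * G)-structure on n points; hence (E + E * G)[1+n] ≅ (E + E * G)[n] + G[n].
-- Both sides have a single structure on the empty order, and induction on n
-- with G = S• finishes the proof.

module Submission where

open import Defs
open import Level using (0ℓ)
open import Data.Nat using (ℕ; zero; suc)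
open import Data.Nat.Properties using (≡-irrelevant)
open import Data.Fin using (Fin; punchIn; punchOut) renaming (zero to 0F; suc to 1+)
open import Data.Fin.Properties using (_≟_; punchOut-cong)
open import Data.Fin.Permutation as Perm using (Permutation; Permutation′; _⟨$⟩ʳ_; _≈_; insert; remove; insert-remove; remove-insert)
open import Data.Unit using (tt)
open import Data.Product using (_×_; _,_)
open import Data.Sum using (inj₁; inj₂)
open import Data.Sum.Relation.Binary.Pointwise using (_⊎ₛ_; inj₁; inj₂)
open import Data.Sum.Function.Setoid using (_⊎-inverse_)
open import Data.Product.Relation.Binary.Pointwise.NonDependent using (_×ₛ_)
open import Relation.Binary.Bundles using (Setoid)
open import Relation.Binary.PropositionalEquality as ≡ using (_≡_; refl)
open import Relation.Nullary using (¬_; yes; no; contradiction)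
open import Function.Bundles using (Inverse)
open import Function.Definitions using (Congruent; StrictlyInverseˡ; StrictlyInverseʳ)
import Function.Consequences.Setoid as Strict
import Function.Properties.Inverse as Inv
import Relation.Binary.Reasoning.Setoid as SetoidReasoning

open Setoid using (Carrier)

module _ {A B : Setoid 0ℓ 0ℓ} where
  private
    module A = Setoid A
    module B = Setoid B

  mkInverseₛ : (to : A.Carrier → B.Carrier) (from : B.Carrier → A.Carrier) →
               Congruent A._≈_ B._≈_ to → Congruent B._≈_ A._≈_ from →
               StrictlyInverseˡ B._≈_ to from → StrictlyInverseʳ A._≈_ to from →
               Inverse A B
  mkInverseₛ to from to-cong from-cong invˡ invʳ = record
    { to = to ; from = from ; to-cong = to-cong ; from-cong = from-cong
    ; inverse = Strict.strictlyInverseˡ⇒inverseˡ A B to-cong invˡ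
              , Strict.strictlyInverseʳ⇒inverseʳ A B from-cong invʳ
    }

Inverse-setoid : Setoid (Level.suc 0ℓ) 0ℓ
Inverse-setoid = record { Carrier = Setoid 0ℓ 0ℓ ; _≈_ = Inverse ; isEquivalence = Inv.isEquivalence }

⊎ₛ-assoc : (A B C : Setoid 0ℓ 0ℓ) → Inverse ((A ⊎ₛ B) ⊎ₛ C) (A ⊎ₛ (B ⊎ₛ C))
⊎ₛ-assoc A B C = mkInverseₛ to from to-cong from-cong invˡ invʳ
  where
  module L = Setoid ((A ⊎ₛ B) ⊎ₛ C)
  module R = Setoid (A ⊎ₛ (B ⊎ₛ C))
  to : L.Carrier → R.Carrier
  to (inj₁ (inj₁ a)) = inj₁ a
  to (inj₁ (inj₂ b)) = inj₂ (inj₁ b)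
  to (inj₂ c)        = inj₂ (inj₂ c)
  from : R.Carrier → L.Carrier
  from (inj₁ a)        = inj₁ (inj₁ a)
  from (inj₂ (inj₁ b)) = inj₁ (inj₂ b)
  from (inj₂ (inj₂ c)) = inj₂ c
  to-cong : Congruent L._≈_ R._≈_ to
  to-cong (inj₁ (inj₁ p)) = inj₁ p
  to-cong (inj₁ (inj₂ p)) = inj₂ (inj₁ p)
  to-cong (inj₂ p)        = inj₂ (inj₂ p)
  from-cong : Congruent R._≈_ L._≈_ from
  from-cong (inj₁ p)        = inj₁ (inj₁ p)
  from-cong (inj₂ (inj₁ p)) = inj₁ (inj₂ p)
  from-cong (inj₂ (inj₂ p)) = inj₂ p
  invˡ : StrictlyInverseˡ R._≈_ to from
  invˡ (inj₁ _)        = R.refl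
  invˡ (inj₂ (inj₁ _)) = R.refl
  invˡ (inj₂ (inj₂ _)) = R.refl
  invʳ : StrictlyInverseʳ L._≈_ to from
  invʳ (inj₁ (inj₁ _)) = L.refl
  invʳ (inj₁ (inj₂ _)) = L.refl
  invʳ (inj₂ _)        = L.refl

×Fin-suc↔⊎× : (A : Setoid 0ℓ 0ℓ) (n : ℕ) →
  Inverse (A ×ₛ ≡.setoid (Fin (suc n))) (A ⊎ₛ (A ×ₛ ≡.setoid (Fin n)))
×Fin-suc↔⊎× A n = mkInverseₛ to from to-cong from-cong invˡ invʳ
  where
  module A = Setoid A
  module L = Setoid (A ×ₛ ≡.setoid (Fin (suc n)))
  module R = Setoid (A ⊎ₛ (A ×ₛ ≡.setoid (Fin n)))
  to : L.Carrier → R.Carrier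
  to (a , 0F)   = inj₁ a
  to (a , 1+ i) = inj₂ (a , i)
  from : R.Carrier → L.Carrier
  from (inj₁ a)       = a , 0F
  from (inj₂ (a , i)) = a , 1+ i
  to-cong : Congruent L._≈_ R._≈_ to
  to-cong {_ , 0F}   (p , refl) = inj₁ p
  to-cong {_ , 1+ _} (p , refl) = inj₂ (p , refl)
  from-cong : Congruent R._≈_ L._≈_ from
  from-cong (inj₁ p)          = p , refl
  from-cong (inj₂ (p , refl)) = p , refl
  invˡ : StrictlyInverseˡ R._≈_ to from
  invˡ (inj₁ _) = R.refl
  invˡ (inj₂ _) = R.refl
  invʳ : StrictlyInverseʳ L._≈_ to from
  invʳ (_ , 0F)   = L.refl
  invʳ (_ , 1+ _) = L.refl

punchOut-cong₂ : ∀ {n} {i i′ j j′ : Fin (suc n)} → i ≡ i′ → j ≡ j′ →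
  ∀ {i≢j i′≢j′} → punchOut {i = i} {j} i≢j ≡ punchOut {i = i′} {j′} i′≢j′
punchOut-cong₂ {i = i} refl refl = punchOut-cong i refl

remove-cong : ∀ {m n} (i : Fin (suc m)) {π ρ : Permutation (suc m) (suc n)} →
  π ≈ ρ → remove i π ≈ remove i ρ
remove-cong i π≈ρ j = punchOut-cong₂ (π≈ρ i) (π≈ρ (punchIn i j))

insert-cong : ∀ {m n} (i : Fin (suc m)) (j : Fin (suc n)) {π ρ : Permutation m n} →
  π ≈ ρ → insert i j π ≈ insert i j ρ
insert-cong i j π≈ρ k with i ≟ k
... | yes _   = refl
... | no i≢k = ≡.cong (punchIn j) (π≈ρ (punchOut i≢k))

insert-sends : ∀ {m n} (i : Fin (suc m)) (j : Fin (suc n)) (π : Permutation m n) →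
  insert i j π ⟨$⟩ʳ i ≡ j
insert-sends i j π with i ≟ i
... | yes _   = refl
... | no i≢i = contradiction refl i≢i

S-suc↔S×Fin : ∀ m (i : Fin (suc m)) → Inverse (S (suc m)) (S m ×ₛ ≡.setoid (Fin (suc m)))
S-suc↔S×Fin m i = mkInverseₛ to from
  (λ {ρ ρ′} ρ≈ρ′ → remove-cong i {ρ} {ρ′} ρ≈ρ′ , ρ≈ρ′ i)
  (λ { {τ , j} {τ′ , _} (τ≈τ′ , refl) → insert-cong i j {τ} {τ′} τ≈τ′ })
  (λ (τ , j) → remove-insert i j τ , insert-sends i j τ)
  (insert-remove i)
  where
  to : Permutation′ (suc m) → Permutation′ m × Fin (suc m)
  to ρ = remove i ρ , ρ ⟨$⟩ʳ i
  from : Permutation′ m × Fin (suc m) → Permutation′ (suc m)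
  from (τ , j) = insert i j τ

S-suc↔S⊎S• : ∀ m → Inverse (S (suc m)) (S m ⊎ₛ (S •) m)
S-suc↔S⊎S• m = Inv.trans (S-suc↔S×Fin m 0F) (×Fin-suc↔⊎× (S m) m)

S-zero↔E : Inverse (S 0) (E 0)
S-zero↔E = mkInverseₛ (λ _ → tt) (λ _ → Perm.id) (λ _ → refl) (λ _ ()) (λ _ → refl) (λ _ ())

E⊙-suc : (G : LSpecies) (n : ℕ) → Inverse ((E ⊙ G) (suc n)) ((E ⊙ G) n ⊎ₛ G (suc n))
E⊙-suc G n = mkInverseₛ to from to-cong from-cong invˡ invʳ
  -- suc n ∸ toℕ (1+ k) reduces to n ∸ toℕ k, so moving the split point needs no transport
  where
  module L = Setoid ((E ⊙ G) (suc n))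
  module R = Setoid ((E ⊙ G) n ⊎ₛ G (suc n))
  to : L.Carrier → R.Carrier
  to (0F   , tt , b) = inj₂ b
  to (1+ k , tt , b) = inj₁ (k , tt , b)
  from : R.Carrier → L.Carrier
  from (inj₁ (k , tt , b)) = 1+ k , tt , b
  from (inj₂ b)            = 0F , tt , b
  to-cong : Congruent L._≈_ R._≈_ to
  to-cong (⊙eq {0F}   _ q) = inj₂ q
  to-cong (⊙eq {1+ _} p q) = inj₁ (⊙eq p q)
  from-cong : Congruent R._≈_ L._≈_ from
  from-cong (inj₁ (⊙eq p q)) = ⊙eq p q
  from-cong (inj₂ q)         = ⊙eq refl q
  invˡ : StrictlyInverseˡ R._≈_ to from
  invˡ (inj₁ _) = R.refl
  invˡ (inj₂ _) = R.refl
  invʳ : StrictlyInverseʳ L._≈_ to from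
  invʳ (0F   , _) = L.refl
  invʳ (1+ _ , _) = L.refl

module _ (G : LSpecies) where

  X⊙-zero : ¬ Carrier ((X ⊙ G) 0)
  X⊙-zero (0F , () , _)

  X⊙-suc : ∀ n → Inverse ((X ⊙ G) (suc n)) (G n)
  X⊙-suc n = mkInverseₛ to from to-cong (⊙eq refl) (λ _ → G.refl) invʳ
    where
    module G = Setoid (G n)
    module L = Setoid ((X ⊙ G) (suc n))
    -- X forces the initial segment to have exactly one point, so k = 1 is the only case
    to : L.Carrier → G.Carrier
    to (1+ 0F , _ , b) = b
    from : G.Carrier → L.Carrier
    from b = 1+ 0F , refl , b
    to-cong : Congruent L._≈_ G._≈_ to
    to-cong (⊙eq {1+ 0F} _ q) = q
    invʳ : StrictlyInverseʳ L._≈_ to from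
    invʳ (1+ 0F , e , _) = ⊙eq (≡-irrelevant refl e) G.refl

  E+E*-zero : Inverse ((E +ₛ E * G) 0) (E 0)
  E+E*-zero = mkInverseₛ (λ _ → tt) (λ _ → inj₁ tt) (λ _ → refl) (λ _ → inj₁ refl) (λ _ → refl) invʳ
    where
    invʳ : StrictlyInverseʳ (Setoid._≈_ ((E +ₛ E * G) 0)) (λ _ → tt) (λ _ → inj₁ tt)
    invʳ (inj₁ tt)           = inj₁ refl
    invʳ (inj₂ (0F , _ , x)) = contradiction x X⊙-zero

  E+E*-suc : ∀ n → Inverse ((E +ₛ E * G) (suc n)) ((E +ₛ E * G) n ⊎ₛ G n)
  E+E*-suc n = begin
    E n ⊎ₛ (E ⊙ X ⊙ G) (suc n)
      ≈⟨ Inv.refl (E n) ⊎-inverse E⊙-suc (X ⊙ G) n ⟩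
    E n ⊎ₛ ((E * G) n ⊎ₛ (X ⊙ G) (suc n))
      ≈⟨ Inv.refl (E n) ⊎-inverse (Inv.refl ((E * G) n) ⊎-inverse X⊙-suc n) ⟩
    E n ⊎ₛ ((E * G) n ⊎ₛ G n)
      ≈⟨ Inv.sym (⊎ₛ-assoc (E n) ((E * G) n) (G n)) ⟩
    (E n ⊎ₛ (E * G) n) ⊎ₛ G n
      ∎
    where open SetoidReasoning Inverse-setoid

proposition2p8 : S ≅ E +ₛ E * (S •)
proposition2p8 zero    = Inv.trans S-zero↔E (Inv.sym (E+E*-zero (S •)))
proposition2p8 (suc m) = begin
  S (suc m)                      ≈⟨ S-suc↔S⊎S• m ⟩
  S m ⊎ₛ (S •) m                 ≈⟨ proposition2p8 m ⊎-inverse Inv.refl ((S •) m) ⟩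
  (E +ₛ E * (S •)) m ⊎ₛ (S •) m  ≈⟨ Inv.sym (E+E*-suc (S •) m) ⟩
  (E +ₛ E * (S •)) (suc m)       ∎
  where open SetoidReasoning Inverse-setoid
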